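{- Let $G=(V,E)$ and $H=(V_H,E_H)$ be directed graphs and let $A\subseteq V_H\cap V$ be such that for every $u\in A$ the set of incoming edges of $u$ in $H$ equals the set of incoming edges of $u$ in $G$. Then a set of vertices $T\subseteq A$ induces a top SCC in $H$ if and only if it induces a top SCC in $G$.
   Context: A top SCC (tSCC) of a graph is a strongly connected component with no incoming edges from vertices outside it; "$T$ induces a tSCC" means the subgraph induced by $T$ is a tSCC. -}

module Defs where

open import Data.Nat using (ℕ)
open import Data.Bool using (Bool; true)
open import Data.Fin using (Fin)
open import Data.Fin.Subset using (Subset; _∈_; _∉_; _⊆_; Nonempty)
open import Data.Product using (_×_; ∃; ∃-syntax)
open import Relation.Nullary using (¬_)
open import Relation.Binary.PropositionalEquality using (_≡_)
open import Relation.Binary.Construct.Closure.ReflexiveTransitive using (Star)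

-- A finite directed graph whose vertices live in the ambient universe Fin n:
-- vertex set V ⊆ Fin n, edge relation E (decidable, Bool-valued), and every
-- edge joins two vertices of V.
record Digraph (n : ℕ) : Set where
  field
    V  : Subset n
    E  : Fin n → Fin n → Bool
    wf : ∀ x y → E x y ≡ true → x ∈ V × y ∈ V
open Digraph public

module _ {n : ℕ} (G : Digraph n) where

  Edge : Fin n → Fin n → Set
  Edge x y = E G x y ≡ true

  Reach : Fin n → Fin n → Set
  Reach = Star Edge

  StronglyConnected : Subset n → Set
  StronglyConnected S = ∀ x y → x ∈ S → y ∈ S → Reach x y

  IsSCC : Subset n → Set
  IsSCC S = S ⊆ V G × Nonempty S × StronglyConnected S
          × (∀ S′ → S ⊆ S′ → S′ ⊆ V G → StronglyConnected S′ → S′ ⊆ S)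

  IsTopSCC : Subset n → Set
  IsTopSCC S = IsSCC S × ¬ (∃[ v ] ∃[ u ] (Edge v u × u ∈ S × v ∉ S))

module Submission where

-- A top SCC T has no incoming edge from outside, so every vertex
-- that reaches T lies in T; hence paths into T never leave T, and they only
-- use edges entering vertices of T ⊆ A, which H and G share. So strong
-- connectivity and the absence of incoming edges carry over from one graph to
-- the other, and maximality is automatic for a nonempty set closed under
-- predecessors.

open import Defs
open import Data.Nat using (ℕ)
open import Data.Fin.Subset using (Subset; _∈_; _∉_; _⊆_; Nonempty)
open import Data.Fin.Subset.Properties using (_∈?_)
open import Data.Product using (_,_; _×_; ∃-syntax)
open import Data.Empty using (⊥-elim)
open import Relation.Nullary using (¬_; yes; no)
open import Relation.Binary.PropositionalEquality using (_≡_; sym; trans)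
open import Relation.Binary.Construct.Closure.ReflexiveTransitive using (ε; _◅_)
open import Function.Bundles using (_⇔_; mk⇔)

module _ {n : ℕ} where

  NoIncomingEdge : Digraph n → Subset n → Set
  NoIncomingEdge K T = ¬ (∃[ v ] ∃[ u ] (Edge K v u × u ∈ T × v ∉ T))

  SameInEdgesOn : Digraph n → Digraph n → Subset n → Set
  SameInEdgesOn H G A = ∀ u → u ∈ A → ∀ v → E H v u ≡ E G v u

  SameInEdgesOn-sym : ∀ H G {A} → SameInEdgesOn H G A → SameInEdgesOn G H A
  SameInEdgesOn-sym H G same u u∈A v = sym (same u u∈A v)

  noIncoming⇒reach-closed : ∀ K {T} → NoIncomingEdge K T →
                            ∀ {x y} → Reach K x y → y ∈ T → x ∈ T
  noIncoming⇒reach-closed K noInc ε y∈T = y∈T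
  noIncoming⇒reach-closed K {T} noInc {x} (e ◅ path) y∈T with x ∈? T
  ... | yes x∈T = x∈T
  ... | no  x∉T =
    ⊥-elim (noInc (x , _ , e , noIncoming⇒reach-closed K noInc path y∈T , x∉T))

  noIncoming⇒maximal : ∀ K {T} → Nonempty T → NoIncomingEdge K T →
                       ∀ S → T ⊆ S → StronglyConnected K S → S ⊆ T
  noIncoming⇒maximal K (t , t∈T) noInc S T⊆S sc {z} z∈S =
    noIncoming⇒reach-closed K noInc (sc z t z∈S (T⊆S t∈T)) t∈T

  module _ (H G : Digraph n) {A T : Subset n}
           (same : SameInEdgesOn H G A) (T⊆A : T ⊆ A) where

    noIncoming-transfer : NoIncomingEdge H T → NoIncomingEdge G T
    noIncoming-transfer noInc (v , u , e , u∈T , v∉T) =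
      noInc (v , u , trans (same u (T⊆A u∈T) v) e , u∈T , v∉T)

    reach-transfer : NoIncomingEdge H T →
                     ∀ {x y} → Reach H x y → y ∈ T → Reach G x y
    reach-transfer noInc ε y∈T = ε
    reach-transfer noInc {x} (_◅_ {j = z} e path) y∈T =
      trans (sym (same z (T⊆A z∈T) x)) e ◅ reach-transfer noInc path y∈T
      where
      z∈T : z ∈ T
      z∈T = noIncoming⇒reach-closed H noInc path y∈T

    isTopSCC-transfer : A ⊆ V G → IsTopSCC H T → IsTopSCC G T
    isTopSCC-transfer A⊆VG ((_ , nonempty , sc , _) , noInc) =
      ( (λ t∈T → A⊆VG (T⊆A t∈T))
      , nonempty
      , (λ x y x∈T y∈T → reach-transfer noInc (sc x y x∈T y∈T) y∈T)
      , (λ S T⊆S _ → noIncoming⇒maximal G nonempty noIncG S T⊆S) )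
      , noIncG
      where
      noIncG : NoIncomingEdge G T
      noIncG = noIncoming-transfer noInc

mainTheorem10 : (n : ℕ) (G H : Digraph n) (A : Subset n)
    → A ⊆ V H → A ⊆ V G
    → (∀ u → u ∈ A → ∀ v → E H v u ≡ E G v u)
    → (T : Subset n) → T ⊆ A
    → (IsTopSCC H T ⇔ IsTopSCC G T)
mainTheorem10 n G H A A⊆VH A⊆VG same T T⊆A =
  mk⇔ (isTopSCC-transfer H G same T⊆A A⊆VG)
      (isTopSCC-transfer G H (SameInEdgesOn-sym H G same) T⊆A A⊆VH)
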